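{- Let $R$ be a skew partition. Any two complete executions of downward jeu de taquin on $R$ (possibly using different choices of the points $H$ at each slide) produce the same labelled finite lower ideal of $(\mathbb P^2,\preceq)$; that is, the partition obtained by downward jeu de taquin from a skew partition is independent of the choices made during the algorithm.
   Context: $A$ is a finite totally ordered alphabet, $\mathbb P=\{1,2,\ldots\}$. On $\mathbb P^2$ consider the partial order $\preceq$ generated by the covering relations $(1,y)\prec(1,y+1)$ and $(x,y)\prec(x+1,y)$ for all $x,y\in\mathbb P$. An ideal is a finite lower ideal of $(\mathbb P^2,\preceq)$. A skew ideal is a set $S=I\setminus J$ with $J\subseteq I$ ideals. An $A$-labelling of a finite subset $X\subseteq\mathbb P^2$ is an injective map from $X$ to $A$ which is strictly increasing for $\preceq$ restricted to $X$ (if $p\prec q$ then label$(p)<$ label$(q)$). A skew partition is an $A$-labelling of a skew ideal (its shape); a partition is an $A$-labelling of an ideal. A skew partition with a hole is a skew ideal $S=I\setminus J$ together with a point $H\in S$ (the hole) and an $A$-labelling of $S\setminus\{H\}$; $H$ is an upper corner if $I\setminus\{H\}$ is an ideal. Downward move on a skew partition with a hole: if $H$ is an upper corner, remove $H$ from the shape, obtaining a skew partition without hole. Otherwise, consider the points of $S$ covering $H$ in $\preceq$ (there are one or two): if there is one, $K$, move the label of $K$ to $H$ and make $K$ the new hole; if there are two, $K$ and $L$, with labels $x<y$, move $x$ from $K$ to $H$ and make $K$ the new hole. Downward slide on a skew partition of shape $I\setminus J$ with $J\neq\emptyset$: choose a point $H$ maximal in $J$ (for $\preceq$), view $H$ as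 a hole of the shape $(I\setminus J)\cup\{H\}$, and apply downward moves until no hole remains; the resulting shape is of the form $I'\setminus(J\setminus\{H\})$. Downward jeu de taquin: apply downward slides repeatedly until the shape is an ideal (i.e. a partition is obtained). -}

module Defs where

open import Level using (Level; _⊔_)
open import Data.Nat using (ℕ; zero; suc; _<_)
import Data.Nat as ℕ
open import Data.Product using (_×_; _,_; proj₁; proj₂; ∃)
open import Data.Product.Properties using (≡-dec)
open import Data.Bool using (Bool; true; false; _∧_; _∨_; not)
open import Data.Maybe using (Maybe; just; nothing; is-just)
open import Data.Empty using (⊥)
open import Relation.Nullary using (¬_; does)
open import Relation.Binary using (Rel; DecidableEquality)
open import Relation.Binary.PropositionalEquality using (_≡_; _≢_)
open import Relation.Binary.Construct.Closure.ReflexiveTransitive using (Star)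

-- Points of ℙ² (ℙ = {1,2,…}) are encoded 0-based: the pair (x , y) : ℕ × ℕ
-- stands for the point (x+1, y+1) of ℙ².
Point : Set
Point = ℕ × ℕ

_≟P_ : DecidableEquality Point
_≟P_ = ≡-dec ℕ._≟_ ℕ._≟_

data _⋖_ : Point → Point → Set where
  up    : ∀ {y}   → (0 , y) ⋖ (0 , suc y)
  right : ∀ {x y} → (x , y) ⋖ (suc x , y)

_≼_ : Point → Point → Set
_≼_ = Star _⋖_

_≺_ : Point → Point → Set
p ≺ q = p ≼ q × p ≢ q

Subset : Set
Subset = Point → Bool

IsFinite : Subset → Set
IsFinite X = ∃ λ N → ∀ p → X p ≡ true → proj₁ p < N × proj₂ p < N

IsLowerSet : Subset → Set
IsLowerSet X = ∀ {p q} → p ≼ q → X q ≡ true → X p ≡ true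

IsIdeal : Subset → Set
IsIdeal X = IsFinite X × IsLowerSet X

_∪_ : Subset → Subset → Subset
(X ∪ Y) p = X p ∨ Y p

_-pt_ : Subset → Point → Subset
(X -pt H) p = X p ∧ not (does (p ≟P H))

⟦_⟧ : Point → Subset
⟦ H ⟧ p = does (p ≟P H)

module _ {a : Level} (A : Set a) where

  Labelling : Set a
  Labelling = Point → Maybe A

  -- configuration: the (formal) subtracted ideal J, together with the
  -- labels; the shape is I ∖ J with I = J ∪ dom L.
  record Config : Set a where
    constructor config
    field
      J : Subset
      L : Labelling

  -- state of a downward slide: either a skew partition with a hole
  -- (J, labels, hole H; I = J ∪ dom L ∪ {H}), or a finished configuration.
  data State : Set a where
    hole : Subset → Labelling → Point → State
    done : Subset → Labelling → State

module _ {a : Level} {A : Set a} where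

  dom : Labelling A → Subset
  dom L p = is-just (L p)

  _[_≔_] : Labelling A → Point → Maybe A → Labelling A
  (L [ H ≔ v ]) p with p ≟P H
  ... | Relation.Nullary.yes _ = v
  ... | Relation.Nullary.no  _ = L p

  shapeI : Config A → Subset
  shapeI c = Config.J c ∪ dom (Config.L c)

module _ {a ℓ : Level} {A : Set a} (_<ᴬ_ : Rel A ℓ) where

  IsSkewPartition : Config A → Set (a ⊔ ℓ)
  IsSkewPartition (config J L) =
      IsIdeal J
    × IsIdeal (J ∪ dom L)
    × (∀ p → J p ≡ true → L p ≡ nothing)
    × (∀ {p q x} → L p ≡ just x → L q ≡ just x → p ≡ q)
    × (∀ {p q x y} → p ≺ q → L p ≡ just x → L q ≡ just y → x <ᴬ y)

  holeI : Subset → Labelling A → Point → Subset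
  holeI J L H = (J ∪ dom L) ∪ ⟦ H ⟧

  InS : Subset → Labelling A → Point → Point → Set
  InS J L H p = holeI J L H p ≡ true × J p ≡ false

  UpperCorner : Subset → Labelling A → Point → Set
  UpperCorner J L H = IsIdeal (holeI J L H -pt H)

  data Move : State A → State A → Set (a ⊔ ℓ) where
    corner : ∀ {J L H} → UpperCorner J L H →
             Move (hole J L H) (done J L)
    one    : ∀ {J L H K x} → ¬ UpperCorner J L H →
             H ⋖ K → InS J L H K →
             (∀ K′ → H ⋖ K′ → InS J L H K′ → K′ ≡ K) →
             L K ≡ just x →
             Move (hole J L H) (hole J ((L [ H ≔ just x ]) [ K ≔ nothing ]) K)
    two    : ∀ {J L H K K′ x y} → ¬ UpperCorner J L H →
             H ⋖ K → H ⋖ K′ → K ≢ K′ → InS J L H K → InS J L H K′ →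
             L K ≡ just x → L K′ ≡ just y → x <ᴬ y →
             Move (hole J L H) (hole J ((L [ H ≔ just x ]) [ K ≔ nothing ]) K)

  MaximalIn : Subset → Point → Set
  MaximalIn J H = J H ≡ true × (∀ q → J q ≡ true → H ≼ q → q ≡ H)

  data Slide : Config A → Config A → Set (a ⊔ ℓ) where
    slide : ∀ {J L H J′ L′} → MaximalIn J H →
            Star Move (hole (J -pt H) L H) (done J′ L′) →
            Slide (config J L) (config J′ L′)

  -- a complete execution of downward jeu de taquin from R ending in P
  -- (J of P is empty, i.e. P is a partition)
  JdT : Config A → Config A → Set (a ⊔ ℓ)
  JdT R P = Star Slide R P × (∀ p → Config.J P p ≡ false)

-- The order ≼ is a tree rooted at (1,1): the points below any point form a chain.
-- Downward moves are deterministic, so a slide is determined by the chosen maximal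
-- point H of J, and it only changes labels in the up-set ↑H. Distinct maximal points
-- of J have disjoint up-sets, so slides at two of them commute. The one non-local
-- ingredient of a move, the upper-corner test, still transfers: a slide leaves an
-- ideal behind, which can be glued to an ideal living in the other up-set. The
-- diamond property then gives uniqueness of the final partition by induction on one
-- of the two executions.
module Submission where

open import Defs
open import Level using (Level)
open import Data.Product using (Σ; _×_; _,_; proj₁; proj₂; ∃; ∃₂)
open import Data.List using (List)
open import Data.List.Membership.Propositional using (_∈_)
open import Relation.Binary using (Rel; IsStrictTotalOrder; Decidable; Asymmetric)
open import Relation.Binary.PropositionalEquality
  using (_≡_; _≢_; _≗_; refl; sym; trans; cong; cong₂)
open import Data.Nat using (_≤_; _<_; _≤′_; ≤′-refl; ≤′-step; z≤n; _+_; _≤?_)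
import Data.Nat as ℕ
open import Data.Nat.Properties
  using (≤-refl; ≤-trans; ≤-total; n≤1+n; ≤⇒≤′; <-≤-trans; m≤m+n; m≤n+m)
open import Data.Sum using (_⊎_; inj₁; inj₂)
open import Data.Empty using (⊥-elim)
open import Function using (case_of_; _∘_)
open import Data.Bool using (true; false; _∧_; _∨_; not)
open import Data.Bool.Properties using (∧-identityʳ; ∧-zeroʳ; ∨-identityʳ)
open import Data.Maybe using (just; nothing; is-just)
open import Relation.Nullary using (¬_; yes; no; does)
open import Relation.Nullary.Decidable using (_×-dec_; _⊎-dec_; map′)
open import Relation.Binary.Construct.Closure.ReflexiveTransitive using (Star; ε; _◅_; _◅◅_)

_⊑_ : Point → Point → Set
(x , y) ⊑ (a , b) = (x ≡ 0 × y ≤ b) ⊎ (y ≡ b × x ≤ a)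

≼⇒⊑ : ∀ {p q} → p ≼ q → p ⊑ q
≼⇒⊑ ε = inj₂ (refl , ≤-refl)
≼⇒⊑ (up ◅ r) with ≼⇒⊑ r
... | inj₁ (_ , y<b) = inj₁ (refl , ≤-trans (n≤1+n _) y<b)
... | inj₂ (refl , _) = inj₁ (refl , n≤1+n _)
≼⇒⊑ (right ◅ r) with ≼⇒⊑ r
... | inj₁ (() , _)
... | inj₂ (refl , x<a) = inj₂ (refl , ≤-trans (n≤1+n _) x<a)

≼-right : ∀ {x a y} → x ≤′ a → (x , y) ≼ (a , y)
≼-right ≤′-refl = ε
≼-right (≤′-step x≤a) = ≼-right x≤a ◅◅ (right ◅ ε)

≼-up : ∀ {y b} → y ≤′ b → (0 , y) ≼ (0 , b)
≼-up ≤′-refl = ε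
≼-up (≤′-step y≤b) = ≼-up y≤b ◅◅ (up ◅ ε)

⊑⇒≼ : ∀ {x y a b} → (x , y) ⊑ (a , b) → (x , y) ≼ (a , b)
⊑⇒≼ (inj₁ (refl , y≤b)) = ≼-up (≤⇒≤′ y≤b) ◅◅ ≼-right (≤⇒≤′ z≤n)
⊑⇒≼ (inj₂ (refl , x≤a)) = ≼-right (≤⇒≤′ x≤a)

_≼?_ : Decidable _≼_
(x , y) ≼? (a , b) =
  map′ ⊑⇒≼ ≼⇒⊑ ((x ℕ.≟ 0 ×-dec y ≤? b) ⊎-dec (y ℕ.≟ b ×-dec x ≤? a))

≼-comparable-below : ∀ {p r q} → p ≼ q → r ≼ q → p ≼ r ⊎ r ≼ p
≼-comparable-below {x , y} {u , v} p≼q r≼q with ≼⇒⊑ p≼q | ≼⇒⊑ r≼q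
... | inj₁ (refl , _) | inj₁ (refl , _) with ≤-total y v
...   | inj₁ y≤v = inj₁ (⊑⇒≼ (inj₁ (refl , y≤v)))
...   | inj₂ v≤y = inj₂ (⊑⇒≼ (inj₁ (refl , v≤y)))
≼-comparable-below p≼q r≼q | inj₁ (refl , y≤b) | inj₂ (refl , _) = inj₁ (⊑⇒≼ (inj₁ (refl , y≤b)))
≼-comparable-below p≼q r≼q | inj₂ (refl , _) | inj₁ (refl , v≤b) = inj₂ (⊑⇒≼ (inj₁ (refl , v≤b)))
≼-comparable-below {x , y} {u , v} p≼q r≼q | inj₂ (refl , _) | inj₂ (refl , _) with ≤-total x u
...   | inj₁ x≤u = inj₁ (⊑⇒≼ (inj₂ (refl , x≤u)))
...   | inj₂ u≤x = inj₂ (⊑⇒≼ (inj₂ (refl , u≤x)))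

⋖⇒≢ : ∀ {p q} → p ⋖ q → p ≢ q
⋖⇒≢ up ()
⋖⇒≢ right ()

⋖-atMostTwo : ∀ {H K K′ K″} → H ⋖ K → H ⋖ K′ → K ≢ K′ → H ⋖ K″ → K″ ≡ K ⊎ K″ ≡ K′
⋖-atMostTwo up    up    K≢K′ _     = ⊥-elim (K≢K′ refl)
⋖-atMostTwo right right K≢K′ _     = ⊥-elim (K≢K′ refl)
⋖-atMostTwo up    right _    up    = inj₁ refl
⋖-atMostTwo up    right _    right = inj₂ refl
⋖-atMostTwo right up    _    up    = inj₂ refl
⋖-atMostTwo right up    _    right = inj₁ refl

≼⇒≢-outside : ∀ {H K q} → H ≼ K → ¬ H ≼ q → q ≢ K
≼⇒≢-outside H≼K H⋠q refl = H⋠q H≼K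

-pt-true : ∀ X {H p} → (X -pt H) p ≡ true → X p ≡ true × p ≢ H
-pt-true X {H} {p} e with X p | p ≟P H
... | true  | no p≢H = refl , p≢H
-pt-true _ () | true | yes _
-pt-true _ () | false | _

-pt-other : ∀ X {H p} → p ≢ H → (X -pt H) p ≡ X p
-pt-other X {H} {p} p≢H with p ≟P H
... | yes p≡H = ⊥-elim (p≢H p≡H)
... | no _    = ∧-identityʳ (X p)

-pt-self : ∀ X {H} → (X -pt H) H ≡ false
-pt-self X {H} with H ≟P H
... | yes _   = ∧-zeroʳ (X H)
... | no H≢H = ⊥-elim (H≢H refl)

-pt-cong : ∀ {X Y H} → X ≗ Y → (X -pt H) ≗ (Y -pt H)
-pt-cong {H = H} X≗Y p = cong (_∧ not (does (p ≟P H))) (X≗Y p)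

-pt-comm : ∀ X H₁ H₂ → ((X -pt H₁) -pt H₂) ≗ ((X -pt H₂) -pt H₁)
-pt-comm X H₁ H₂ p with X p | does (p ≟P H₁) | does (p ≟P H₂)
... | false | _     | _     = refl
... | true  | true  | true  = refl
... | true  | true  | false = refl
... | true  | false | true  = refl
... | true  | false | false = refl

⟦⟧-other : ∀ {K p} → p ≢ K → ⟦ K ⟧ p ≡ false
⟦⟧-other {K} {p} p≢K with p ≟P K
... | yes p≡K = ⊥-elim (p≢K p≡K)
... | no _    = refl

IsIdeal-resp : ∀ {X Y : Subset} → X ≗ Y → IsIdeal X → IsIdeal Y
IsIdeal-resp X≗Y ((N , bound) , lower) =
  (N , λ p Yp → bound p (trans (X≗Y p) Yp)) ,
  λ {p} {q} p≼q Yq → trans (sym (X≗Y p)) (lower p≼q (trans (X≗Y q) Yq))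

-- As ≼ is a tree, every descent out of ↑H passes strictly below H.
IsIdeal-glue : ∀ {X Y Z : Subset} H → IsIdeal Y → IsIdeal Z →
  (∀ p → p ≺ H → Z p ≡ true) →
  (∀ q → H ≼ q → X q ≡ Y q) → (∀ q → ¬ H ≼ q → X q ≡ Z q) → IsIdeal X
IsIdeal-glue {X} H ((N₁ , boundY) , lowerY) ((N₂ , boundZ) , lowerZ) belowH inside outside =
  (N₁ + N₂ , bound) , lower
  where
  bound : ∀ p → X p ≡ true → proj₁ p < N₁ + N₂ × proj₂ p < N₁ + N₂
  bound p Xp with H ≼? p
  ... | yes H≼p = let (x< , y<) = boundY p (trans (sym (inside p H≼p)) Xp)
                  in <-≤-trans x< (m≤m+n N₁ N₂) , <-≤-trans y< (m≤m+n N₁ N₂)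
  ... | no H⋠p  = let (x< , y<) = boundZ p (trans (sym (outside p H⋠p)) Xp)
                  in <-≤-trans x< (m≤n+m N₂ N₁) , <-≤-trans y< (m≤n+m N₂ N₁)
  lower : IsLowerSet X
  lower {p} {q} p≼q Xq with H ≼? q | H ≼? p
  ... | _ | yes H≼p = trans (inside p H≼p) (lowerY p≼q (trans (sym (inside _ H≼q′)) Xq))
    where H≼q′ = H≼p ◅◅ p≼q
  ... | no H⋠q | no H⋠p = trans (outside p H⋠p) (lowerZ p≼q (trans (sym (outside q H⋠q)) Xq))
  ... | yes H≼q | no H⋠p with ≼-comparable-below p≼q H≼q
  ...   | inj₁ p≼H = trans (outside p H⋠p) (belowH p (p≼H , λ { refl → H⋠p ε }))
  ...   | inj₂ H≼p = ⊥-elim (H⋠p H≼p)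

module _ {a : Level} {A : Set a} where

  update-same : ∀ {L : Labelling A} {K v} → (L [ K ≔ v ]) K ≡ v
  update-same {K = K} with K ≟P K
  ... | yes _   = refl
  ... | no K≢K = ⊥-elim (K≢K refl)

  update-other : ∀ {L : Labelling A} {K v p} → p ≢ K → (L [ K ≔ v ]) p ≡ L p
  update-other {K = K} {p = p} p≢K with p ≟P K
  ... | yes p≡K = ⊥-elim (p≢K p≡K)
  ... | no _    = refl

  update-cong : ∀ {L M : Labelling A} {K v p} → M p ≡ L p → (M [ K ≔ v ]) p ≡ (L [ K ≔ v ]) p
  update-cong {K = K} {p = p} Mp≡Lp with p ≟P K
  ... | yes _ = refl
  ... | no _  = Mp≡Lp

  update₂-outside : ∀ {L : Labelling A} {H K K′ v w q} → H ≼ K → H ≼ K′ → ¬ H ≼ q →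
                    ((L [ K ≔ v ]) [ K′ ≔ w ]) q ≡ L q
  update₂-outside H≼K H≼K′ H⋠q =
    trans (update-other (≼⇒≢-outside H≼K′ H⋠q)) (update-other (≼⇒≢-outside H≼K H⋠q))

module _ {a ℓ : Level} {A : Set a} (_<ᴬ_ : Rel A ℓ) where

  Run : Subset → Labelling A → Point → Subset → Labelling A → Set _
  Run J L K Jd Ld = Star (Move _<ᴬ_) (hole J L K) (done Jd Ld)

  holeI-cong : ∀ {J L J′ M K q} → J′ q ≡ J q → M q ≡ L q → holeI _<ᴬ_ J′ M K q ≡ holeI _<ᴬ_ J L K q
  holeI-cong {K = K} {q} J′q≡Jq Mq≡Lq = cong (_∨ ⟦ K ⟧ q) (cong₂ _∨_ J′q≡Jq (cong is-just Mq≡Lq))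

  holeI-pt-other : ∀ {J L K p} → p ≢ K → (holeI _<ᴬ_ J L K -pt K) p ≡ (J ∪ dom L) p
  holeI-pt-other {J} {L} {K} {p} p≢K =
    trans (-pt-other (holeI _<ᴬ_ J L K) p≢K)
          (trans (cong ((J ∪ dom L) p ∨_) (⟦⟧-other p≢K)) (∨-identityʳ _))

  holeI-pt-cong : ∀ {J L J′ M K q} → J′ q ≡ J q → M q ≡ L q →
                  (holeI _<ᴬ_ J′ M K -pt K) q ≡ (holeI _<ᴬ_ J L K -pt K) q
  holeI-pt-cong {J} {L} {J′} {M} {K} {q} J′q≡Jq Mq≡Lq =
    cong (_∧ not (does (q ≟P K))) (holeI-cong {J} {L} {J′} {M} {K} {q} J′q≡Jq Mq≡Lq)

  InS-resp : ∀ {J L J′ M K q} → J′ q ≡ J q → M q ≡ L q → InS _<ᴬ_ J L K q → InS _<ᴬ_ J′ M K q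
  InS-resp {J} {L} {J′} {M} {K} {q} J′q≡Jq Mq≡Lq (inI , ∉J) =
    trans (holeI-cong {J} {L} {J′} {M} {K} {q} J′q≡Jq Mq≡Lq) inI , trans J′q≡Jq ∉J

  UpperCorner-resp : ∀ {J L J′ M K} → J′ ≗ J → M ≗ L → UpperCorner _<ᴬ_ J L K → UpperCorner _<ᴬ_ J′ M K
  UpperCorner-resp {J} {L} {J′} {M} {K} J′≗J M≗L =
    IsIdeal-resp λ p → sym (holeI-pt-cong {J} {L} {J′} {M} {K} (J′≗J p) (M≗L p))

  covered⇒¬UpperCorner : ∀ {J L K K′} → K ⋖ K′ → InS _<ᴬ_ J L K K′ → ¬ UpperCorner _<ᴬ_ J L K
  covered⇒¬UpperCorner {J} {L} {K} K⋖K′ (K′∈I , _) (_ , lower)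
    with trans (sym (-pt-self (holeI _<ᴬ_ J L K)))
               (lower (K⋖K′ ◅ ε) (trans (-pt-other (holeI _<ᴬ_ J L K) (⋖⇒≢ K⋖K′ ∘ sym)) K′∈I))
  ... | ()

  UpperCorner⇒ideal : ∀ {J L K} → J K ≡ false → L K ≡ nothing →
                      UpperCorner _<ᴬ_ J L K → IsIdeal (J ∪ dom L)
  UpperCorner⇒ideal {J} {L} {K} JK≡false LK≡nothing = IsIdeal-resp agree
    where
    agree : (holeI _<ᴬ_ J L K -pt K) ≗ (J ∪ dom L)
    agree p = case p ≟P K of λ
      { (yes refl) → trans (-pt-self (holeI _<ᴬ_ J L K))
                           (sym (cong₂ _∨_ JK≡false (cong is-just LK≡nothing)))
      ; (no p≢K)   → holeI-pt-other {J} {L} p≢K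
      }

  run-ideal : ∀ {J L K Jd Ld} → Run J L K Jd Ld → J K ≡ false → L K ≡ nothing → IsIdeal (Jd ∪ dom Ld)
  run-ideal {J} {L} {K} (corner uc ◅ ε) JK LK = UpperCorner⇒ideal {J} {L} {K} JK LK uc
  run-ideal (corner _ ◅ (() ◅ _))
  run-ideal {L = L} {H} (one {K = K} {x = x} _ _ (_ , JK) _ _ ◅ r) _ _ =
    run-ideal r JK (update-same {L = L [ H ≔ just x ]} {K})
  run-ideal {L = L} {H} (two {K = K} {x = x} _ _ _ _ (_ , JK) _ _ _ _ ◅ r) _ _ =
    run-ideal r JK (update-same {L = L [ H ≔ just x ]} {K})

  run-done : ∀ {J L K Jd Ld} → Run J L K Jd Ld → Jd ≡ J × (∀ q → ¬ K ≼ q → Ld q ≡ L q)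
  run-done (corner _ ◅ ε) = refl , λ _ _ → refl
  run-done (corner _ ◅ (() ◅ _))
  run-done (one _ K⋖K′ _ _ _ ◅ r) with run-done r
  ... | refl , outside = refl , λ q K⋠q →
    trans (outside q λ K′≼q → K⋠q (K⋖K′ ◅ K′≼q)) (update₂-outside ε (K⋖K′ ◅ ε) K⋠q)
  run-done (two _ K⋖K′ _ _ _ _ _ _ _ ◅ r) with run-done r
  ... | refl , outside = refl , λ q K⋠q →
    trans (outside q λ K′≼q → K⋠q (K⋖K′ ◅ K′≼q)) (update₂-outside ε (K⋖K′ ◅ ε) K⋠q)

  Move-deterministic : Asymmetric _<ᴬ_ →
                       ∀ {s t u} → Move _<ᴬ_ s t → Move _<ᴬ_ s u → t ≡ u
  Move-deterministic _ (corner _) (corner _) = refl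
  Move-deterministic _ (corner uc) (one ¬uc _ _ _ _) = ⊥-elim (¬uc uc)
  Move-deterministic _ (corner uc) (two ¬uc _ _ _ _ _ _ _ _) = ⊥-elim (¬uc uc)
  Move-deterministic _ (one ¬uc _ _ _ _) (corner uc) = ⊥-elim (¬uc uc)
  Move-deterministic _ (two ¬uc _ _ _ _ _ _ _ _) (corner uc) = ⊥-elim (¬uc uc)
  Move-deterministic _ (one _ _ _ unique LK) (one _ c i _ LK′) with unique _ c i
  ... | refl with trans (sym LK) LK′
  ...   | refl = refl
  Move-deterministic _ (one _ _ _ unique _) (two _ c c′ K≢K′ i i′ _ _ _) =
    ⊥-elim (K≢K′ (trans (unique _ c i) (sym (unique _ c′ i′))))
  Move-deterministic _ (two _ c c′ K≢K′ i i′ _ _ _) (one _ _ _ unique _) =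
    ⊥-elim (K≢K′ (trans (unique _ c i) (sym (unique _ c′ i′))))
  Move-deterministic asym (two _ c c′ K≢K′ _ _ LK LK′ x<y) (two _ d d′ L≢L′ _ _ LL LL′ u<v)
    with ⋖-atMostTwo c c′ K≢K′ d
  ... | inj₁ refl with trans (sym LK) LL
  ...   | refl = refl
  Move-deterministic asym (two _ c c′ K≢K′ _ _ LK LK′ x<y) (two _ d d′ L≢L′ _ _ LL LL′ u<v)
      | inj₂ refl with ⋖-atMostTwo c c′ K≢K′ d′
  ...   | inj₂ refl = ⊥-elim (L≢L′ refl)
  ...   | inj₁ refl with trans (sym LL) LK′ | trans (sym LL′) LK
  ...     | refl | refl = ⊥-elim (asym x<y u<v)

  Run-deterministic : Asymmetric _<ᴬ_ →
                      ∀ {s J₁ L₁ J₂ L₂} →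
                      Star (Move _<ᴬ_) s (done J₁ L₁) → Star (Move _<ᴬ_) s (done J₂ L₂) →
                      done {A = A} J₁ L₁ ≡ done J₂ L₂
  Run-deterministic _ ε ε = refl
  Run-deterministic _ ε (() ◅ _)
  Run-deterministic _ (() ◅ _) ε
  Run-deterministic asym (m ◅ r) (m′ ◅ r′) with Move-deterministic asym m m′
  ... | refl = Run-deterministic asym r r′

  record SameAbove (H : Point) (L₀ M₀ L M : Labelling A) : Set a where
    field
      above     : ∀ q → H ≼ q → M q ≡ L q
      L-outside : ∀ q → ¬ H ≼ q → L q ≡ L₀ q
      M-outside : ∀ q → ¬ H ≼ q → M q ≡ M₀ q

  SameAbove⇒≗ : ∀ {H L₀ M₀ L M} → M₀ ≗ L₀ → SameAbove H L₀ M₀ L M → M ≗ L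
  SameAbove⇒≗ {H} M₀≗L₀ s q with H ≼? q
  ... | yes H≼q = SameAbove.above s q H≼q
  ... | no H⋠q  =
    trans (SameAbove.M-outside s q H⋠q) (trans (M₀≗L₀ q) (sym (SameAbove.L-outside s q H⋠q)))

  SameAbove-update₂ : ∀ {H L₀ M₀ L M K K′ v w} → H ≼ K → H ≼ K′ → SameAbove H L₀ M₀ L M →
                      SameAbove H L₀ M₀ ((L [ K ≔ v ]) [ K′ ≔ w ]) ((M [ K ≔ v ]) [ K′ ≔ w ])
  SameAbove-update₂ {L = L} {M} {K} {K′} {v} {w} H≼K H≼K′ s = record
    { above     = λ q H≼q → update-cong {L = L [ K ≔ v ]} {M [ K ≔ v ]} {K′} {w} {q}
                                (update-cong {L = L} {M} {K} {v} {q} (SameAbove.above s q H≼q))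
    ; L-outside = λ q H⋠q → trans (update₂-outside {L = L} H≼K H≼K′ H⋠q) (SameAbove.L-outside s q H⋠q)
    ; M-outside = λ q H⋠q → trans (update₂-outside {L = M} H≼K H≼K′ H⋠q) (SameAbove.M-outside s q H⋠q)
    }

  -- Moves read and write only inside ↑H, except for the upper-corner test; hence that
  -- test is the one thing the replayed configuration must be shown to reproduce.
  module Replay (H : Point) {J J′ : Subset} {L₀ M₀ : Labelling A}
                (J-above : ∀ q → H ≼ q → J′ q ≡ J q)
                (corner-transfer : ∀ {L M K} → H ≼ K → SameAbove H L₀ M₀ L M →
                                   UpperCorner _<ᴬ_ J L K → UpperCorner _<ᴬ_ J′ M K) where

    run-replay : ∀ {L M K Jd Ld} → H ≼ K → SameAbove H L₀ M₀ L M → Run J L K Jd Ld →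
                 ∃ λ Md → Run J′ M K J′ Md × SameAbove H L₀ M₀ Ld Md
    run-replay H≼K s (corner uc ◅ ε) = _ , corner (corner-transfer H≼K s uc) ◅ ε , s
    run-replay H≼K s (corner _ ◅ (() ◅ _))
    run-replay {L} {M} {K} H≼K s (one {K = K′} _ K⋖K′ K′∈S unique LK′ ◅ r)
      with run-replay (H≼K ◅◅ (K⋖K′ ◅ ε)) (SameAbove-update₂ H≼K (H≼K ◅◅ (K⋖K′ ◅ ε)) s) r
    ... | Md , r′ , s′ =
      Md , one (covered⇒¬UpperCorner {J′} {M} K⋖K′ K′∈S′) K⋖K′ K′∈S′ unique′
               (trans (above _ H≼K′) LK′) ◅ r′ , s′
      where
      open SameAbove s
      H≼K′ : H ≼ K′
      H≼K′ = H≼K ◅◅ (K⋖K′ ◅ ε)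
      K′∈S′ : InS _<ᴬ_ J′ M K K′
      K′∈S′ = InS-resp {J} {L} {J′} {M} (J-above _ H≼K′) (above _ H≼K′) K′∈S
      unique′ : ∀ K″ → K ⋖ K″ → InS _<ᴬ_ J′ M K K″ → K″ ≡ K′
      unique′ K″ K⋖K″ K″∈S′ = unique K″ K⋖K″
        (InS-resp {J′} {M} {J} {L} (sym (J-above _ H≼K″)) (sym (above _ H≼K″)) K″∈S′)
        where H≼K″ = H≼K ◅◅ (K⋖K″ ◅ ε)
    run-replay {L} {M} {K} H≼K s (two {K = K′} {K″} _ K⋖K′ K⋖K″ K′≢K″ K′∈S K″∈S LK′ LK″ x<y ◅ r)
      with run-replay (H≼K ◅◅ (K⋖K′ ◅ ε)) (SameAbove-update₂ H≼K (H≼K ◅◅ (K⋖K′ ◅ ε)) s) r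
    ... | Md , r′ , s′ =
      Md , two (covered⇒¬UpperCorner {J′} {M} K⋖K′ K′∈S′) K⋖K′ K⋖K″ K′≢K″ K′∈S′ K″∈S′
               (trans (above _ H≼K′) LK′) (trans (above _ H≼K″) LK″) x<y ◅ r′ , s′
      where
      open SameAbove s
      H≼K′ : H ≼ K′
      H≼K′ = H≼K ◅◅ (K⋖K′ ◅ ε)
      H≼K″ : H ≼ K″
      H≼K″ = H≼K ◅◅ (K⋖K″ ◅ ε)
      K′∈S′ : InS _<ᴬ_ J′ M K K′
      K′∈S′ = InS-resp {J} {L} {J′} {M} (J-above _ H≼K′) (above _ H≼K′) K′∈S
      K″∈S′ : InS _<ᴬ_ J′ M K K″
      K″∈S′ = InS-resp {J} {L} {J′} {M} (J-above _ H≼K″) (above _ H≼K″) K″∈S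

  open Replay using (run-replay)

  infix 4 _⟶_ _⟶*_ _≈ᶜ_

  _⟶_ : Config A → Config A → Set _
  _⟶_ = Slide _<ᴬ_

  _⟶*_ : Config A → Config A → Set _
  _⟶*_ = Star _⟶_

  _≈ᶜ_ : Config A → Config A → Set a
  X ≈ᶜ Y = Config.J X ≗ Config.J Y × Config.L X ≗ Config.L Y

  ≈ᶜ-trans : ∀ {X Y Z} → X ≈ᶜ Y → Y ≈ᶜ Z → X ≈ᶜ Z
  ≈ᶜ-trans (J≗ , L≗) (J≗′ , L≗′) = (λ p → trans (J≗ p) (J≗′ p)) , (λ p → trans (L≗ p) (L≗′ p))

  IsStraight : Config A → Set
  IsStraight P = ∀ p → Config.J P p ≡ false

  record Admissible (X : Config A) : Set a where
    field
      J-lower      : IsLowerSet (Config.J X)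
      J-unlabelled : ∀ p → Config.J X p ≡ true → Config.L X p ≡ nothing

  straight⇒¬Slide : ∀ {X Y} → IsStraight X → ¬ X ⟶ Y
  straight⇒¬Slide straight (slide {H = H} (H∈J , _) _) with trans (sym (straight H)) H∈J
  ... | ()

  MaximalIn-pt : ∀ {J H₁ H₂} → MaximalIn _<ᴬ_ J H₂ → H₂ ≢ H₁ → MaximalIn _<ᴬ_ (J -pt H₁) H₂
  MaximalIn-pt {J} (H₂∈J , maximal) H₂≢H₁ =
    trans (-pt-other J H₂≢H₁) H₂∈J , λ q q∈J-H₁ → maximal q (proj₁ (-pt-true J q∈J-H₁))

  MaximalIn-disjoint : ∀ {J H₁ H₂} → MaximalIn _<ᴬ_ J H₁ → MaximalIn _<ᴬ_ J H₂ → H₁ ≢ H₂ →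
                       ∀ q → H₂ ≼ q → ¬ H₁ ≼ q
  MaximalIn-disjoint (H₁∈J , max₁) (H₂∈J , max₂) H₁≢H₂ q H₂≼q H₁≼q with ≼-comparable-below H₁≼q H₂≼q
  ... | inj₁ H₁≼H₂ = H₁≢H₂ (sym (max₁ _ H₂∈J H₁≼H₂))
  ... | inj₂ H₂≼H₁ = H₁≢H₂ (max₂ _ H₁∈J H₂≼H₁)

  Slide-admissible : ∀ {X Y} → Admissible X → X ⟶ Y → Admissible Y
  Slide-admissible {config J L} ad (slide {H = H} {L′ = L′} (_ , maximal) r) with run-done r
  ... | refl , outside = record { J-lower = lower ; J-unlabelled = unlabelled }
    where
    open Admissible ad
    lower : IsLowerSet (J -pt H)
    lower {p} p≼q q∈J-H with -pt-true J q∈J-H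
    ... | q∈J , q≢H = trans (-pt-other J λ { refl → q≢H (maximal _ q∈J p≼q) }) (J-lower p≼q q∈J)
    unlabelled : ∀ p → (J -pt H) p ≡ true → L′ p ≡ nothing
    unlabelled p p∈J-H with -pt-true J p∈J-H
    ... | p∈J , p≢H = trans (outside p λ H≼p → p≢H (maximal p p∈J H≼p)) (J-unlabelled p p∈J)

  Slide-resp-≈ᶜ : ∀ {X X′ Y} → X ≈ᶜ X′ → X ⟶ Y → ∃ λ Y′ → X′ ⟶ Y′ × Y ≈ᶜ Y′
  Slide-resp-≈ᶜ {config J L} {config J′ L′} (J≗J′ , L≗L′) (slide {H = H} (H∈J , maximal) r)
    with run-done r
  ... | refl , _ with run-replay H J′-pt≗ corner-transfer ε initial r
    where
    J′-pt≗ : ∀ q → H ≼ q → (J′ -pt H) q ≡ (J -pt H) q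
    J′-pt≗ q _ = -pt-cong (λ p → sym (J≗J′ p)) q
    initial : SameAbove H L L′ L L′
    initial = record
      { above     = λ q _ → sym (L≗L′ q)
      ; L-outside = λ _ _ → refl
      ; M-outside = λ _ _ → refl
      }
    corner-transfer : ∀ {Ls Ms K} → H ≼ K → SameAbove H L L′ Ls Ms →
                      UpperCorner _<ᴬ_ (J -pt H) Ls K → UpperCorner _<ᴬ_ (J′ -pt H) Ms K
    corner-transfer _ s = UpperCorner-resp (-pt-cong λ q → sym (J≗J′ q))
                                           (SameAbove⇒≗ (λ q → sym (L≗L′ q)) s)
  ... | Md , r′ , s =
    config (J′ -pt H) Md ,
    slide (trans (sym (J≗J′ H)) H∈J , λ q q∈J′ → maximal q (trans (J≗J′ q) q∈J′)) r′ ,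
    -pt-cong J≗J′ , (λ q → sym (SameAbove⇒≗ (λ q → sym (L≗L′ q)) s q))

  Slides-resp-≈ᶜ : ∀ {X X′ P} → X ≈ᶜ X′ → X ⟶* P → ∃ λ P′ → X′ ⟶* P′ × P ≈ᶜ P′
  Slides-resp-≈ᶜ X≈X′ ε = _ , ε , X≈X′
  Slides-resp-≈ᶜ X≈X′ (s ◅ r) with Slide-resp-≈ᶜ X≈X′ s
  ... | Y′ , s′ , Y≈Y′ with Slides-resp-≈ᶜ Y≈Y′ r
  ...   | P′ , r′ , P≈P′ = P′ , s′ ◅ r′ , P≈P′

  slide-after-slide : ∀ {J L H₁ H₂ L₁ L₂} → Admissible (config J L) →
    MaximalIn _<ᴬ_ J H₁ → MaximalIn _<ᴬ_ J H₂ → H₁ ≢ H₂ →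
    Run (J -pt H₁) L H₁ (J -pt H₁) L₁ → Run (J -pt H₂) L H₂ (J -pt H₂) L₂ →
    ∃ λ L₁₂ → Run ((J -pt H₁) -pt H₂) L₁ H₂ ((J -pt H₁) -pt H₂) L₁₂ × SameAbove H₂ L L₁ L₂ L₁₂
  slide-after-slide {J} {L} {H₁} {H₂} {L₁} ad max₁@(H₁∈J , maximal₁) max₂@(H₂∈J , _) H₁≢H₂ r₁ r₂ =
    run-replay H₂ J-above corner-transfer ε initial r₂
    where
    open Admissible ad
    disjoint : ∀ q → H₂ ≼ q → ¬ H₁ ≼ q
    disjoint = MaximalIn-disjoint max₁ max₂ H₁≢H₂
    J-above : ∀ q → H₂ ≼ q → ((J -pt H₁) -pt H₂) q ≡ (J -pt H₂) q
    J-above q H₂≼q = trans (-pt-comm J H₁ H₂ q) (-pt-other (J -pt H₂) λ { refl → disjoint q H₂≼q ε })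
    initial : SameAbove H₂ L L₁ L L₁
    initial = record
      { above     = λ q H₂≼q → proj₂ (run-done r₁) q (disjoint q H₂≼q)
      ; L-outside = λ _ _ → refl
      ; M-outside = λ _ _ → refl
      }
    I₁ : Subset
    I₁ = (J -pt H₁) ∪ dom L₁
    I₁-ideal : IsIdeal I₁
    I₁-ideal = run-ideal r₁ (-pt-self J) (J-unlabelled H₁ H₁∈J)
    below-H₂ : ∀ p → p ≺ H₂ → I₁ p ≡ true
    below-H₂ p (p≼H₂ , _) = cong (_∨ is-just (L₁ p))
      (trans (-pt-other J λ { refl → H₁≢H₂ (sym (maximal₁ H₂ H₂∈J p≼H₂)) }) (J-lower p≼H₂ H₂∈J))
    corner-transfer : ∀ {Ls Ms K} → H₂ ≼ K → SameAbove H₂ L L₁ Ls Ms →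
                      UpperCorner _<ᴬ_ (J -pt H₂) Ls K → UpperCorner _<ᴬ_ ((J -pt H₁) -pt H₂) Ms K
    corner-transfer {Ls} {Ms} {K} H₂≼K s uc = IsIdeal-glue H₂ uc I₁-ideal below-H₂ inside outside
      where
      open SameAbove s
      inside : ∀ q → H₂ ≼ q →
               (holeI _<ᴬ_ ((J -pt H₁) -pt H₂) Ms K -pt K) q ≡ (holeI _<ᴬ_ (J -pt H₂) Ls K -pt K) q
      inside q H₂≼q =
        holeI-pt-cong {J -pt H₂} {Ls} {(J -pt H₁) -pt H₂} {Ms} (J-above q H₂≼q) (above q H₂≼q)
      outside : ∀ q → ¬ H₂ ≼ q → (holeI _<ᴬ_ ((J -pt H₁) -pt H₂) Ms K -pt K) q ≡ I₁ q
      outside q H₂⋠q = trans (holeI-pt-other {(J -pt H₁) -pt H₂} {Ms} (≼⇒≢-outside H₂≼K H₂⋠q))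
        (cong₂ _∨_ (-pt-other (J -pt H₁) (≼⇒≢-outside ε H₂⋠q)) (cong is-just (M-outside q H₂⋠q)))

  slides-commute : ∀ {J L H₁ H₂ L₁ L₂} → Admissible (config J L) →
    MaximalIn _<ᴬ_ J H₁ → MaximalIn _<ᴬ_ J H₂ → H₁ ≢ H₂ →
    Run (J -pt H₁) L H₁ (J -pt H₁) L₁ → Run (J -pt H₂) L H₂ (J -pt H₂) L₂ →
    ∃₂ λ Z₁ Z₂ → config (J -pt H₁) L₁ ⟶ Z₁ × config (J -pt H₂) L₂ ⟶ Z₂ × Z₁ ≈ᶜ Z₂
  slides-commute {J} {H₁ = H₁} {H₂} ad max₁ max₂ H₁≢H₂ r₁ r₂
    with slide-after-slide ad max₁ max₂ H₁≢H₂ r₁ r₂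
       | slide-after-slide ad max₂ max₁ (H₁≢H₂ ∘ sym) r₂ r₁
  ... | L₁₂ , r₁₂ , s₁₂ | L₂₁ , r₂₁ , s₂₁ =
    _ , _ , slide (MaximalIn-pt max₂ (H₁≢H₂ ∘ sym)) r₁₂ , slide (MaximalIn-pt max₁ H₁≢H₂) r₂₁ ,
    -pt-comm J H₁ H₂ , same-labels
    where
    open SameAbove
    same-labels : L₁₂ ≗ L₂₁
    same-labels p with H₂ ≼? p | H₁ ≼? p
    ... | yes H₂≼p | _ = trans (above s₁₂ p H₂≼p)
                               (sym (M-outside s₂₁ p (MaximalIn-disjoint max₁ max₂ H₁≢H₂ p H₂≼p)))
    ... | no H₂⋠p | yes H₁≼p = trans (M-outside s₁₂ p H₂⋠p) (sym (above s₂₁ p H₁≼p))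
    ... | no H₂⋠p | no H₁⋠p =
      trans (M-outside s₁₂ p H₂⋠p) (trans (L-outside s₂₁ p H₁⋠p)
        (sym (trans (M-outside s₂₁ p H₁⋠p) (L-outside s₁₂ p H₂⋠p))))

  module _ (asym : Asymmetric _<ᴬ_) where

    slide-diamond : ∀ {X Y₁ Y₂} → Admissible X → X ⟶ Y₁ → X ⟶ Y₂ →
                    Y₁ ≡ Y₂ ⊎ ∃₂ λ Z₁ Z₂ → Y₁ ⟶ Z₁ × Y₂ ⟶ Z₂ × Z₁ ≈ᶜ Z₂
    slide-diamond ad (slide {H = H₁} max₁ r₁) (slide {H = H₂} max₂ r₂)
      with run-done r₁ | run-done r₂ | H₁ ≟P H₂
    ... | refl , _ | refl , _ | no H₁≢H₂ = inj₂ (slides-commute ad max₁ max₂ H₁≢H₂ r₁ r₂)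
    ... | refl , _ | refl , _ | yes refl with Run-deterministic asym r₁ r₂
    ...   | refl = inj₁ refl

    straight-after-slide : ∀ {X Y P} → Admissible X → X ⟶* P → IsStraight P → X ⟶ Y →
                           ∃ λ P′ → Y ⟶* P′ × P ≈ᶜ P′
    straight-after-slide _ ε P-straight s = ⊥-elim (straight⇒¬Slide P-straight s)
    straight-after-slide ad (s₁ ◅ rest) P-straight s₂ with slide-diamond ad s₁ s₂
    ... | inj₁ refl = _ , rest , (λ _ → refl) , (λ _ → refl)
    ... | inj₂ (Z₁ , Z₂ , t₁ , t₂ , Z₁≈Z₂)
      with straight-after-slide (Slide-admissible ad s₁) rest P-straight t₁
    ...   | P′ , r′ , P≈P′ with Slides-resp-≈ᶜ Z₁≈Z₂ r′
    ...     | P″ , r″ , P′≈P″ = P″ , t₂ ◅ r″ , ≈ᶜ-trans P≈P′ P′≈P″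

    straight-unique : ∀ {X P Q} → Admissible X → X ⟶* P → IsStraight P →
                      X ⟶* Q → IsStraight Q → Config.L P ≗ Config.L Q
    straight-unique _ ε _ ε _ _ = refl
    straight-unique _ ε P-straight (s ◅ _) _ = ⊥-elim (straight⇒¬Slide P-straight s)
    straight-unique _ (s ◅ _) _ ε Q-straight = ⊥-elim (straight⇒¬Slide Q-straight s)
    straight-unique ad (s ◅ r) P-straight (t ◅ r′) Q-straight p
      with straight-after-slide ad (t ◅ r′) Q-straight s
    ... | Q′ , r″ , (J≗ , L≗) =
      trans (straight-unique (Slide-admissible ad s) r P-straight r″ Q′-straight p) (sym (L≗ p))
      where
      Q′-straight : IsStraight Q′
      Q′-straight q = trans (sym (J≗ q)) (Q-straight q)

theorem9p3 : ∀ {a ℓ : Level} {A : Set a} {_<ᴬ_ : Rel A ℓ} →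
    IsStrictTotalOrder _≡_ _<ᴬ_ →
    Σ (List A) (λ xs → ∀ x → x ∈ xs) →
    (R P Q : Config A) →
    IsSkewPartition _<ᴬ_ R →
    JdT _<ᴬ_ R P →
    JdT _<ᴬ_ R Q →
    ∀ p → Config.L P p ≡ Config.L Q p
theorem9p3 {_<ᴬ_ = _<ᴬ_} sto _ R P Q (J-ideal , _ , J-unlabelled , _ , _)
           (R→P , P-straight) (R→Q , Q-straight) =
  straight-unique _<ᴬ_ (IsStrictTotalOrder.asym sto) admissible R→P P-straight R→Q Q-straight
  where
  admissible : Admissible _<ᴬ_ R
  admissible = record { J-lower = proj₂ J-ideal ; J-unlabelled = J-unlabelled }
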